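{- Let $G$ be the barbell graph consisting of two vertex-disjoint cliques, each on $n$ vertices, together with a single additional edge joining a vertex of one clique to a vertex of the other. Then $\mathrm{AC}(G)=\Theta(n)$.
   Context: Acquaintance time: for a connected graph, place one agent on each vertex. Two agents are acquainted once they occupy the two endpoints of a common edge at some time (including the initial placement). In each round one chooses a matching (set of pairwise vertex-disjoint edges, not necessarily maximal), and for every edge of it the two agents on its endpoints swap places. A strategy for acquaintance is a sequence of matchings after which every pair of agents has been acquainted; $\mathrm{AC}(G)$ is the minimum number of rounds in such a strategy. -}

module Defs where

open import Data.Nat using (ℕ; zero; suc; _*_; _≤_)
open import Data.Bool using (Bool)
open import Data.Fin using (Fin; toℕ)
open import Data.List using (List; []; _∷_; length)
open import Data.List.Relation.Unary.All using (All)
open import Data.Product using (Σ; ∃; _×_; _,_)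
open import Data.Sum using (_⊎_)
open import Relation.Nullary using (¬_)
open import Relation.Binary.PropositionalEquality using (_≡_; _≢_)
open import Function using (_∘_; id)

-- Agents are named by their initial vertex, so a configuration is a map
-- c : V → V sending each vertex to the agent currently standing on it.

-- Swapping along the matching turns configuration c into c ∘ σ.
IsMatching : {V : Set} → (V → V → Set) → (V → V) → Set
IsMatching {V} E σ = (∀ v → σ (σ v) ≡ v) × (∀ v → (σ v ≡ v) ⊎ E v (σ v))

MeetNow : {V : Set} → (V → V → Set) → (V → V) → V → V → Set
MeetNow {V} E c a b = Σ V λ u → Σ V λ v → E u v × c u ≡ a × c v ≡ b

Meets : {V : Set} → (V → V → Set) → (V → V) → List (V → V) → V → V → Set
Meets E c []       a b = MeetNow E c a b
Meets E c (σ ∷ ms) a b = MeetNow E c a b ⊎ Meets E (c ∘ σ) ms a b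

IsAcqStrategy : {V : Set} → (V → V → Set) → List (V → V) → Set
IsAcqStrategy {V} E ms = All (IsMatching E) ms × (∀ (a b : V) → a ≢ b → Meets E id ms a b)

ACAtMost : {V : Set} → (V → V → Set) → ℕ → Set
ACAtMost {V} E k = Σ (List (V → V)) λ ms → IsAcqStrategy E ms × length ms ≤ k

Barbell : (n : ℕ) → Bool × Fin n → Bool × Fin n → Set
Barbell n (s , i) (t , j) = (s ≡ t × i ≢ j) ⊎ (s ≢ t × toℕ i ≡ 0 × toℕ j ≡ 0)

module Submission where

-- Upper bound.  Write n = m + 1; in clique s the bridge end is (s , 0).
-- Phase t (t = 1 … m) swaps agents across the bridge and then, in both
-- cliques, swaps the agent at the bridge end with the agent at (s , t).
-- After t phases the agent of (s , t) sits at the bridge end of clique s,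
-- while the agents of (s , 0 … t-1) have been carried over to positions
-- 1 … t of the other clique.  Hence (s , x) and (not s , y) meet at time
-- max x y, and agents of one clique meet at time 0.  The bookkeeping of
-- "a strategy realising a prescribed sequence of configurations" is done
-- once for arbitrary graphs (module Timeline).
--
-- Lower bound.  For any graph whose cross edges between two sides only join
-- "portal" vertices, an agent that never stands on a portal never changes
-- side, so two such agents from different sides never meet (module
-- Separation).  With k rounds at most 2(k+1) agents ever stand on the two
-- bridge ends, so some agent of each clique never does: n ≤ 2(k+1) ≤ 4k.

open import Defs
open import Data.Nat using (ℕ; zero; suc; _+_; _*_; _≤_; _<_; _<ᵇ_; s≤s; z≤n; _<?_; _≤?_)
open import Data.Nat.Properties as ℕP
  using (<ᵇ⇒<; <⇒<ᵇ; ≤-refl; ≤-trans; ≤-total; ≤-pred; ≰⇒>; <-irrefl; <-≤-trans;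
         m≤n⇒m<n∨m≡n; m<1+n⇒m<n∨m≡n; m≤n⇒m≤1+n; n≤1+n; m⊓n≤n; m≤n⇒m⊓n≡m;
         +-identityʳ; +-comm; *-comm; +-monoˡ-≤; *-monoˡ-≤; *-mono-≤)
open import Data.Nat.Tactic.RingSolver using (solve-∀)
open import Data.Bool using (Bool; true; false; not; if_then_else_)
open import Data.Bool.Properties using (not-involutive; not-¬; ¬-not) renaming (_≟_ to _≟ᴮ_)
open import Data.Fin as F using (Fin; toℕ; fromℕ<; inject₁)
open import Data.Fin.Properties as FinP
  using (toℕ-injective; toℕ-fromℕ<; toℕ-inject₁; toℕ<n; pigeonhole; ¬∀⟶∃¬) renaming (_≟_ to _≟ᶠ_)
open import Data.List using (List; []; _∷_; _++_; length; map; lookup)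
open import Data.List.Properties using (length-++; length-map)
open import Data.List.Relation.Unary.All using (All; []; _∷_)
open import Data.List.Relation.Unary.All.Properties using (++⁺)
open import Data.List.Relation.Unary.Any using (here; there; index)
open import Data.List.Relation.Unary.Any.Properties using (lookup-index)
open import Data.List.Membership.Propositional using (_∈_; _∉_)
open import Data.List.Membership.Propositional.Properties using (∈-map⁺; ∈-++⁺ˡ; ∈-++⁺ʳ)
import Data.List.Membership.DecPropositional as DecMembership
open import Data.Product using (Σ; ∃; _×_; _,_; proj₁; proj₂)
open import Data.Product.Properties using (≡-dec)
open import Data.Sum using (_⊎_; inj₁; inj₂)
open import Relation.Nullary using (¬_; yes; no; does; contradiction)
open import Relation.Binary using (DecidableEquality)
open import Relation.Binary.PropositionalEquality
open import Function using (_∘_; id)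

module Acquaintance {V : Set} (E : V → V → Set) where

  run : (V → V) → List (V → V) → (V → V)
  run c []       = c
  run c (σ ∷ ms) = run (c ∘ σ) ms

  run-++ : ∀ c xs ys → run c (xs ++ ys) ≡ run (run c xs) ys
  run-++ c []       ys = refl
  run-++ c (σ ∷ xs) ys = run-++ (c ∘ σ) xs ys

  run-resp : ∀ {c c'} ms → c ≗ c' → run c ms ≗ run c' ms
  run-resp []       c≗c' = c≗c'
  run-resp (σ ∷ ms) c≗c' = run-resp ms (c≗c' ∘ σ)

  meetNow-resp : ∀ {c c' a b} → c ≗ c' → MeetNow E c' a b → MeetNow E c a b
  meetNow-resp c≗c' (u , v , e , p , q) = u , v , e , trans (c≗c' u) p , trans (c≗c' v) q

  meets-start : ∀ {c a b} ms → MeetNow E c a b → Meets E c ms a b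
  meets-start []      mn = mn
  meets-start (_ ∷ _) mn = inj₁ mn

  meets-++ˡ : ∀ {c a b} xs ys → Meets E c xs a b → Meets E c (xs ++ ys) a b
  meets-++ˡ []       ys mn        = meets-start ys mn
  meets-++ˡ (σ ∷ xs) ys (inj₁ mn) = inj₁ mn
  meets-++ˡ (σ ∷ xs) ys (inj₂ ms) = inj₂ (meets-++ˡ xs ys ms)

  meets-end : ∀ {c a b} xs → MeetNow E (run c xs) a b → Meets E c xs a b
  meets-end []       mn = mn
  meets-end (σ ∷ xs) mn = inj₂ (meets-end xs mn)

  meetNow-sym : (∀ {u v} → E u v → E v u) → ∀ {c a b} → MeetNow E c a b → MeetNow E c b a
  meetNow-sym E-sym (u , v , e , p , q) = v , u , E-sym e , q , p

  -- A strategy built from blocks of rounds, block t leading from the prescribed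
  -- configuration conf t to conf (t + 1): every meeting in some conf t is realised.
  module Timeline (conf : ℕ → V → V) (block : ℕ → List (V → V)) where

    schedule : ℕ → List (V → V)
    schedule zero    = []
    schedule (suc T) = schedule T ++ block T

    Realises : ℕ → Set
    Realises T = ∀ t → t < T → run (conf t) (block t) ≗ conf (suc t)

    run-schedule : ∀ {c} T → c ≗ conf 0 → Realises T → run c (schedule T) ≗ conf T
    run-schedule zero    c≗conf₀ steps = c≗conf₀
    run-schedule {c} (suc T) c≗conf₀ steps v =
      begin
        run c (schedule T ++ block T) v          ≡⟨ cong (λ f → f v) (run-++ c (schedule T) (block T)) ⟩
        run (run c (schedule T)) (block T) v     ≡⟨ run-resp (block T) (run-schedule T c≗conf₀ (λ t → steps t ∘ m≤n⇒m≤1+n)) v ⟩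
        run (conf T) (block T) v                 ≡⟨ steps T ≤-refl v ⟩
        conf (suc T) v                           ∎
      where open ≡-Reasoning

    meets-by : ∀ {c a b} T t → c ≗ conf 0 → Realises T → t ≤ T →
               MeetNow E (conf t) a b → Meets E c (schedule T) a b
    meets-by T t c≗conf₀ steps t≤T mn with m≤n⇒m<n∨m≡n t≤T
    meets-by T       t c≗conf₀ steps t≤T mn | inj₂ refl =
      meets-end (schedule T) (meetNow-resp (run-schedule T c≗conf₀ steps) mn)
    meets-by (suc T) t c≗conf₀ steps t≤T mn | inj₁ (s≤s t≤T') =
      meets-++ˡ (schedule T) (block T) (meets-by T t c≗conf₀ (λ t → steps t ∘ m≤n⇒m≤1+n) t≤T' mn)

    schedule-matchings : (∀ t → All (IsMatching E) (block t)) → ∀ T → All (IsMatching E) (schedule T)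
    schedule-matchings blocks zero    = []
    schedule-matchings blocks (suc T) = ++⁺ (schedule-matchings blocks T) (blocks T)

    schedule-length : ∀ {d} → (∀ t → length (block t) ≡ d) → ∀ T → length (schedule T) ≡ T * d
    schedule-length         lengths zero    = refl
    schedule-length {d} lengths (suc T) =
      begin
        length (schedule T ++ block T)          ≡⟨ length-++ (schedule T) ⟩
        length (schedule T) + length (block T)  ≡⟨ cong₂ _+_ (schedule-length lengths T) (lengths T) ⟩
        T * d + d                               ≡⟨ +-comm (T * d) d ⟩
        suc T * d                               ∎
      where open ≡-Reasoning

-- A graph split into two sides such that every edge between the sides joins two
-- portal vertices: agents that never stand on a portal stay on their side.
module Separation {V : Set} (E : V → V → Set) (side : V → Bool) (portals : List V)
  (cross-edge : ∀ {u v} → E u v → side u ≢ side v → u ∈ portals × v ∈ portals) where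

  visitors : (V → V) → List (V → V) → List V
  visitors c []       = map c portals
  visitors c (σ ∷ ms) = map c portals ++ visitors (c ∘ σ) ms

  visitors-length : ∀ c ms → length (visitors c ms) ≡ suc (length ms) * length portals
  visitors-length c []       = trans (length-map c portals) (sym (+-identityʳ _))
  visitors-length c (σ ∷ ms) =
    trans (length-++ (map c portals))
          (cong₂ _+_ (length-map c portals) (visitors-length (c ∘ σ) ms))

  on-portal : ∀ c ms {v} → v ∈ portals → c v ∈ visitors c ms
  on-portal c []      v∈ = ∈-map⁺ c v∈
  on-portal c (_ ∷ _) v∈ = ∈-++⁺ˡ (∈-map⁺ c v∈)

  StaysOn : (V → V) → V → Bool → Set
  StaysOn c a s = ∀ v → c v ≡ a → side v ≡ s

  off-portals : ∀ c ms {a w} → a ∉ visitors c ms → c w ≡ a → w ∉ portals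
  off-portals c ms a∉ refl w∈ = a∉ (on-portal c ms w∈)

  same-side : ∀ {u v} → E u v → u ∉ portals ⊎ v ∉ portals → side u ≡ side v
  same-side {u} {v} e off with side u ≟ᴮ side v | off
  ... | yes eq | _       = eq
  ... | no ne  | inj₁ u∉ = contradiction (proj₁ (cross-edge e ne)) u∉
  ... | no ne  | inj₂ v∉ = contradiction (proj₂ (cross-edge e ne)) v∉

  stays-on-step : ∀ c σ ms {a s} → IsMatching E σ → a ∉ visitors c (σ ∷ ms) →
                  StaysOn c a s → StaysOn (c ∘ σ) a s
  stays-on-step c σ ms (_ , edge) a∉ stays v cσv≡a with edge v
  ... | inj₁ σv≡v = trans (cong side (sym σv≡v)) (stays (σ v) cσv≡a)
  ... | inj₂ e    =
    trans (same-side e (inj₂ (off-portals c (σ ∷ ms) a∉ cσv≡a))) (stays (σ v) cσv≡a)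

  apart-now : ∀ c ms {a b sa sb} → sa ≢ sb → StaysOn c a sa → StaysOn c b sb →
              a ∉ visitors c ms → ¬ MeetNow E c a b
  apart-now c ms sa≢sb stays-a stays-b a∉ (u , v , e , cu≡a , cv≡b) =
    sa≢sb (trans (sym (stays-a u cu≡a))
            (trans (same-side e (inj₁ (off-portals c ms a∉ cu≡a))) (stays-b v cv≡b)))

  never-meet : ∀ c ms {a b sa sb} → All (IsMatching E) ms → sa ≢ sb →
               StaysOn c a sa → StaysOn c b sb →
               a ∉ visitors c ms → b ∉ visitors c ms → ¬ Meets E c ms a b
  never-meet c []       _            sa≢sb sta stb a∉ b∉ mn = apart-now c [] sa≢sb sta stb a∉ mn
  never-meet c (σ ∷ ms) _            sa≢sb sta stb a∉ b∉ (inj₁ mn) =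
    apart-now c (σ ∷ ms) sa≢sb sta stb a∉ mn
  never-meet c (σ ∷ ms) (σ-mat ∷ mats) sa≢sb sta stb a∉ b∉ (inj₂ mn) =
    never-meet (c ∘ σ) ms mats sa≢sb
      (stays-on-step c σ ms σ-mat a∉ sta) (stays-on-step c σ ms σ-mat b∉ stb)
      (a∉ ∘ ∈-++⁺ʳ (map c portals)) (b∉ ∘ ∈-++⁺ʳ (map c portals)) mn

missing : ∀ {A : Set} {n} → DecidableEquality A → (L : List A) (g : Fin n → A) →
          (∀ {i j} → g i ≡ g j → i ≡ j) → length L < n → ∃ λ i → g i ∉ L
missing {n = n} _≟_ L g g-inj short = ¬∀⟶∃¬ n (λ i → g i ∈ L) (λ i → g i ∈? L) not-all-listed
  where
  open DecMembership _≟_ using (_∈?_)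
  not-all-listed : ¬ (∀ i → g i ∈ L)
  not-all-listed listed with pigeonhole short (λ i → index (listed i))
  ... | i , j , i<j , same-index = FinP.<⇒≢ i<j (g-inj (begin
        g i                          ≡⟨ lookup-index (listed i) ⟩
        lookup L (index (listed i))  ≡⟨ cong (lookup L) same-index ⟩
        lookup L (index (listed j))  ≡⟨ lookup-index (listed j) ⟨
        g j                          ∎))
    where open ≡-Reasoning

-- The barbell graph with n = m + 1; vertex (s , 0) is the bridge end of clique s.
Vertex : ℕ → Set
Vertex m = Bool × Fin (suc m)

barbell-sym : ∀ {n u v} → Barbell n u v → Barbell n v u
barbell-sym (inj₁ (s≡t , i≢j))     = inj₁ (sym s≡t , i≢j ∘ sym)
barbell-sym (inj₂ (s≢t , i₀ , j₀)) = inj₂ (s≢t ∘ sym , j₀ , i₀)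

module Upper (m : ℕ) where
  open Acquaintance (Barbell (suc m))

  -- ⟨ t ⟩ is t as an element of Fin (suc m), meaningful for t ≤ m
  ⟨_⟩ : ℕ → Fin (suc m)
  ⟨ t ⟩ = fromℕ< (s≤s (m⊓n≤n t m))

  toℕ-⟨⟩ : ∀ {t} → t ≤ m → toℕ ⟨ t ⟩ ≡ t
  toℕ-⟨⟩ t≤m = trans (toℕ-fromℕ< _) (m≤n⇒m⊓n≡m t≤m)

  ⟨toℕ⟩ : ∀ x → ⟨ toℕ x ⟩ ≡ x
  ⟨toℕ⟩ x = toℕ-injective (toℕ-⟨⟩ (≤-pred (toℕ<n x)))

  -- the configuration after t phases: the agent of (s , t) is at the bridge end
  -- of clique s, the agents of (s , 0 … t-1) have moved to the other clique
  conf : ℕ → Vertex m → Vertex m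
  conf t (s , F.zero)  = s , ⟨ t ⟩
  conf t (s , F.suc j) = if toℕ j <ᵇ t then (not s , inject₁ j) else (s , F.suc j)

  conf-arrived : ∀ {t s j} → toℕ j < t → conf t (s , F.suc j) ≡ (not s , inject₁ j)
  conf-arrived {t} {j = j} j<t with toℕ j <ᵇ t | <⇒<ᵇ j<t
  ... | true | _ = refl

  conf-waiting : ∀ {t s j} → ¬ toℕ j < t → conf t (s , F.suc j) ≡ (s , F.suc j)
  conf-waiting {t} {j = j} j≮t with toℕ j <ᵇ t | <ᵇ⇒< (toℕ j) t
  ... | true  | j<t = contradiction (j<t _) j≮t
  ... | false | _   = refl

  conf-start : conf 0 ≗ id
  conf-start (s , F.zero)  = refl
  conf-start (s , F.suc j) = conf-waiting {0} (λ ())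

  bridge : Vertex m → Vertex m
  bridge (s , F.zero)  = not s , F.zero
  bridge (s , F.suc j) = s , F.suc j

  pivot : Fin (suc m) → Vertex m → Vertex m
  pivot x (s , F.zero)  = s , x
  pivot x (s , F.suc j) = if does (F.suc j ≟ᶠ x) then (s , F.zero) else (s , F.suc j)

  bridge-matching : IsMatching (Barbell (suc m)) bridge
  bridge-matching = involutive , along-edges
    where
    involutive : ∀ v → bridge (bridge v) ≡ v
    involutive (s , F.zero)  = cong (_, F.zero) (not-involutive s)
    involutive (s , F.suc j) = refl
    along-edges : ∀ v → (bridge v ≡ v) ⊎ Barbell (suc m) v (bridge v)
    along-edges (s , F.zero)  = inj₂ (inj₂ (not-¬ refl , refl , refl))
    along-edges (s , F.suc j) = inj₁ refl

  pivot-to-end : ∀ x s → pivot x (s , x) ≡ (s , F.zero)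
  pivot-to-end F.zero    s = refl
  pivot-to-end (F.suc k) s with k ≟ᶠ k
  ... | yes _  = refl
  ... | no k≢k = contradiction refl k≢k

  pivot-elsewhere : ∀ {x s j} → F.suc j ≢ x → pivot x (s , F.suc j) ≡ (s , F.suc j)
  pivot-elsewhere {x} {j = j} j≢x with F.suc j ≟ᶠ x
  ... | yes j≡x = contradiction j≡x j≢x
  ... | no _    = refl

  pivot-matching : ∀ x → IsMatching (Barbell (suc m)) (pivot x)
  pivot-matching x = involutive , along-edges x
    where
    involutive : ∀ v → pivot x (pivot x v) ≡ v
    involutive (s , F.zero)  = pivot-to-end x s
    involutive (s , F.suc j) with F.suc j ≟ᶠ x
    ... | yes j≡x = cong (s ,_) (sym j≡x)
    ... | no j≢x  = pivot-elsewhere j≢x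
    along-edges : ∀ y v → (pivot y v ≡ v) ⊎ Barbell (suc m) v (pivot y v)
    along-edges F.zero    (s , F.zero) = inj₁ refl
    along-edges (F.suc k) (s , F.zero) = inj₂ (inj₁ (refl , λ ()))
    along-edges y (s , F.suc j) with F.suc j ≟ᶠ y
    ... | yes _ = inj₂ (inj₁ (refl , λ ()))
    ... | no _  = inj₁ refl

  block : ℕ → List (Vertex m → Vertex m)
  block t = bridge ∷ pivot ⟨ suc t ⟩ ∷ []

  block-matchings : ∀ t → All (IsMatching (Barbell (suc m))) (block t)
  block-matchings t = bridge-matching ∷ pivot-matching ⟨ suc t ⟩ ∷ []

  open Timeline conf block

  phase-step : ∀ (w : Fin m) → conf (toℕ w) ∘ bridge ∘ pivot (F.suc w) ≗ conf (suc (toℕ w))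
  phase-step w (s , F.zero) = begin
    conf (toℕ w) (s , F.suc w)  ≡⟨ conf-waiting (<-irrefl refl) ⟩
    s , F.suc w                 ≡⟨ cong (s ,_) (⟨toℕ⟩ (F.suc w)) ⟨
    s , ⟨ suc (toℕ w) ⟩         ∎
    where open ≡-Reasoning
  phase-step w (s , F.suc j) with j ≟ᶠ w
  ... | yes refl = begin
    not s , ⟨ toℕ w ⟩            ≡⟨ cong (λ t → not s , ⟨ t ⟩) (toℕ-inject₁ w) ⟨
    not s , ⟨ toℕ (inject₁ w) ⟩  ≡⟨ cong (not s ,_) (⟨toℕ⟩ (inject₁ w)) ⟩
    not s , inject₁ w            ≡⟨ conf-arrived ≤-refl ⟨
    conf (suc (toℕ w)) (s , F.suc w) ∎
    where open ≡-Reasoning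
  ... | no j≢w with toℕ j <? toℕ w
  ...   | yes j<w = trans (conf-arrived j<w) (sym (conf-arrived (m≤n⇒m≤1+n j<w)))
  ...   | no j≮w  = trans (conf-waiting j≮w) (sym (conf-waiting j≮1+w))
    where
    j≮1+w : ¬ toℕ j < suc (toℕ w)
    j≮1+w j<1+w with m<1+n⇒m<n∨m≡n j<1+w
    ... | inj₁ j<w = j≮w j<w
    ... | inj₂ j≡w = j≢w (toℕ-injective j≡w)

  phases : Realises m
  phases t t<m with fromℕ< t<m | toℕ-fromℕ< t<m
  ... | w | refl rewrite ⟨toℕ⟩ (F.suc w) = phase-step w

  cross-meet : ∀ s x y → toℕ x ≤ toℕ y → MeetNow (Barbell (suc m)) (conf (toℕ y)) (s , x) (not s , y)
  cross-meet s x y x≤y with m≤n⇒m<n∨m≡n x≤y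
  ... | inj₂ x≡y = (s , F.zero) , (not s , F.zero) , inj₂ (not-¬ refl , refl , refl)
                 , cong (s ,_) (trans (cong ⟨_⟩ (sym x≡y)) (⟨toℕ⟩ x)) , cong (not s ,_) (⟨toℕ⟩ y)
  ... | inj₁ x<y = (not s , F.suc w) , (not s , F.zero) , inj₁ (refl , λ ())
                 , trans (conf-arrived w<y) (cong₂ _,_ (not-involutive s) w≡x)
                 , cong (not s ,_) (⟨toℕ⟩ y)
    where
    x<m : toℕ x < m
    x<m = <-≤-trans x<y (≤-pred (toℕ<n y))
    w : Fin m
    w = fromℕ< x<m
    w<y : toℕ w < toℕ y
    w<y = subst (_< toℕ y) (sym (toℕ-fromℕ< x<m)) x<y
    w≡x : inject₁ w ≡ x
    w≡x = toℕ-injective (trans (toℕ-inject₁ w) (toℕ-fromℕ< x<m))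

  meeting-time : ∀ a b → a ≢ b → ∃ λ t → t ≤ m × MeetNow (Barbell (suc m)) (conf t) a b
  meeting-time (s , x) (s' , y) a≢b with s ≟ᴮ s'
  ... | yes refl = 0 , z≤n , meetNow-resp conf-start
                     ((s , x) , (s , y) , inj₁ (refl , a≢b ∘ cong (s ,_)) , refl , refl)
  ... | no s≢s' with ¬-not (s≢s' ∘ sym) | ≤-total (toℕ x) (toℕ y)
  ...   | refl | inj₁ x≤y = toℕ y , ≤-pred (toℕ<n y) , cross-meet s x y x≤y
  ...   | refl | inj₂ y≤x = toℕ x , ≤-pred (toℕ<n x) , meetNow-sym barbell-sym
          (subst (λ r → MeetNow (Barbell (suc m)) (conf (toℕ x)) (not s , y) (r , x))
                 (not-involutive s) (cross-meet (not s) y x y≤x))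

  upper-bound : ACAtMost (Barbell (suc m)) (4 * suc m)
  upper-bound = schedule m , (schedule-matchings block-matchings m , meet) , short
    where
    meet : ∀ a b → a ≢ b → Meets (Barbell (suc m)) id (schedule m) a b
    meet a b a≢b with meeting-time a b a≢b
    ... | t , t≤m , mn = meets-by m t (sym ∘ conf-start) phases t≤m mn
    short : length (schedule m) ≤ 4 * suc m
    short = begin
      length (schedule m)  ≡⟨ schedule-length (λ _ → refl) m ⟩
      m * 2                ≤⟨ *-mono-≤ (n≤1+n m) (s≤s (s≤s z≤n)) ⟩
      suc m * 4            ≡⟨ *-comm (suc m) 4 ⟩
      4 * suc m            ∎
      where open ℕP.≤-Reasoning

module Lower (m : ℕ) where

  portals : List (Vertex m)
  portals = (true , F.zero) ∷ (false , F.zero) ∷ []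

  bridge-end : ∀ s (i : Fin (suc m)) → toℕ i ≡ 0 → (s , i) ∈ portals
  bridge-end true  F.zero _ = here refl
  bridge-end false F.zero _ = there (here refl)

  cross-edge : ∀ {u v} → Barbell (suc m) u v → proj₁ u ≢ proj₁ v → u ∈ portals × v ∈ portals
  cross-edge                 (inj₁ (s≡t , _))     s≢t = contradiction s≡t s≢t
  cross-edge {s , i} {t , j} (inj₂ (_ , i₀ , j₀)) _   = bridge-end s i i₀ , bridge-end t j j₀

  open Separation (Barbell (suc m)) proj₁ portals cross-edge

  _≟ⱽ_ : DecidableEquality (Vertex m)
  _≟ⱽ_ = ≡-dec _≟ᴮ_ _≟ᶠ_

  starts-on-side : ∀ s i → StaysOn id (s , i) s
  starts-on-side s i v v≡a = cong proj₁ v≡a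

  lower-bound : ∀ k → ACAtMost (Barbell (suc m)) k → suc m ≤ suc k * 2
  lower-bound k (ms , (matchings , meets) , ms≤k) = begin
    suc m                      ≤⟨ everyone-visits ⟩
    length (visitors id ms)    ≡⟨ visitors-length id ms ⟩
    suc (length ms) * 2        ≤⟨ *-monoˡ-≤ 2 (s≤s ms≤k) ⟩
    suc k * 2                  ∎
    where
    open ℕP.≤-Reasoning
    -- otherwise some agent of each clique never reaches a bridge end
    everyone-visits : suc m ≤ length (visitors id ms)
    everyone-visits with suc m ≤? length (visitors id ms)
    ... | yes enough = enough
    ... | no too-few
      with missing _≟ⱽ_ (visitors id ms) (true ,_) (cong proj₂) (≰⇒> too-few)
         | missing _≟ⱽ_ (visitors id ms) (false ,_) (cong proj₂) (≰⇒> too-few)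
    ...   | i , i∉ | j , j∉ =
      contradiction (meets (true , i) (false , j) (λ ()))
        (never-meet id ms matchings (λ ()) (starts-on-side true i) (starts-on-side false j) i∉ j∉)

-- once n ≥ 3, a bound n ≤ 2(k + 1) forces k ≥ 1 and hence n ≤ 4k
linear-from-affine : ∀ {n k} → 3 ≤ n → n ≤ suc k * 2 → n ≤ 4 * k
linear-from-affine {k = zero}  3≤n n≤2 = contradiction (≤-trans 3≤n n≤2) λ { (s≤s (s≤s ())) }
linear-from-affine {n} {suc k} _   n≤  = begin
  n                          ≤⟨ n≤ ⟩
  suc (suc k) * 2            ≤⟨ *-monoˡ-≤ 2 (+-monoˡ-≤ (suc k) {1} {suc k} (s≤s z≤n)) ⟩
  (suc k + suc k) * 2        ≡⟨ double-twice (suc k) ⟩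
  4 * suc k                  ∎
  where
  open ℕP.≤-Reasoning
  double-twice : ∀ x → (x + x) * 2 ≡ 4 * x
  double-twice = solve-∀

proposition4p1 : Σ ℕ λ c → Σ ℕ λ N → ∀ (n : ℕ) → N ≤ n →
    ACAtMost (Barbell n) (c * n) × (∀ (k : ℕ) → ACAtMost (Barbell n) k → n ≤ c * k)
proposition4p1 = 4 , 3 , bounds
  where
  bounds : ∀ n → 3 ≤ n → ACAtMost (Barbell n) (4 * n) × (∀ k → ACAtMost (Barbell n) k → n ≤ 4 * k)
  bounds (suc m) 3≤n = Upper.upper-bound m , λ k ac → linear-from-affine {k = k} 3≤n (Lower.lower-bound m k ac)
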